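{- Let $b\geq 1$ be odd, let $1\leq k\leq n-2$, and let $\mathbf{s}=s_1\ldots s_k$ be such that the set $\mathbf{s}\,|\,R_n(b)$ is nonempty. Let $\mathbf{t}$ be the $\prec$-last sequence in $\mathbf{s}\,|\,R_n(b)$, and let $M=\min\{b,\max\{s_i\}_{i=1}^k+1\}$. Then: (1) if $\sum_{i=1}^k s_i$ is even and $M$ is odd, then $\mathbf{t}=\mathbf{s}M0\ldots0$; (2) if $\sum_{i=1}^k s_i$ is even and $M$ is even, then $\mathbf{t}=\mathbf{s}M(M+1)0\ldots0$; (3) if $\sum_{i=1}^k s_i$ is odd, then $\mathbf{t}=\mathbf{s}0\ldots0$. (In each case the sequence is completed with zeros up to length $n$.)
   Context: A restricted growth function of length $n$ is an integer sequence $s_1\ldots s_n$ with $s_1=0$ and $0\leq s_{i+1}\leq \max\{s_j\}_{j=1}^{i}+1$ for $1\leq i\leq n-1$; $R_n$ is the set of these, and $R_n(b)=\{s\in R_n:\max_i s_i\leq b\}$. For a sequence $\mathbf{u}$ and a set $S$ of sequences, $\mathbf{u}\,|\,S$ denotes the subset of $S$ of sequences having prefix $\mathbf{u}$. The Reflected Gray Code Order $\prec$ on integer sequences of length $n$ with entries in $\{0,\ldots,m-1\}$: $s_1\ldots s_n\prec t_1\ldots t_n$ if for some $k$ with $s_i=t_i$ ($i<k$) and $s_k\neq t_k$, either $\sum_{i=1}^{k-1}s_i$ is even and $s_k<t_k$, or it is odd and $s_k>t_k$. The $\prec$-last sequence of a set is its last element when listed in increasing $\prec$ order. -}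

module Defs where

open import Data.Nat using (ℕ; zero; suc; _+_; _≤_; _<_; _⊔_; _⊓_; _%_)
open import Data.List using (List; []; _∷_; _++_; length; foldr)
open import Data.Nat.ListAction using (sum)
open import Data.List.Relation.Unary.All using (All)
open import Data.Product using (_×_; Σ; ∃; ∃-syntax)
open import Data.Sum using (_⊎_)
open import Data.Unit using (⊤)
open import Relation.Binary.PropositionalEquality using (_≡_; _≢_)

maxL : List ℕ → ℕ
maxL = foldr _⊔_ 0

RGFrom : ℕ → List ℕ → Set
RGFrom m []       = ⊤
RGFrom m (x ∷ xs) = (x ≤ suc m) × RGFrom (m ⊔ x) xs

IsRGF : List ℕ → Set
IsRGF []       = ⊤
IsRGF (x ∷ xs) = (x ≡ 0) × RGFrom 0 xs

InRnb : ℕ → ℕ → List ℕ → Set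
InRnb n b s = (length s ≡ n) × IsRGF s × All (_≤ b) s

InPrefRnb : List ℕ → ℕ → ℕ → List ℕ → Set
InPrefRnb u n b s = (Σ (List ℕ) λ v → s ≡ u ++ v) × InRnb n b s

GrayLt : List ℕ → List ℕ → Set
GrayLt s t =
  ∃[ p ] ∃[ x ] ∃[ y ] ∃[ xs ] ∃[ ys ]
    (s ≡ p ++ (x ∷ xs)) × (t ≡ p ++ (y ∷ ys)) ×
    (((sum p % 2 ≡ 0) × (x < y)) ⊎ ((sum p % 2 ≡ 1) × (y < x)))

IsGrayLast : (List ℕ → Set) → List ℕ → Set
IsGrayLast P t = P t × (∀ u → P u → u ≢ t → GrayLt u t)

-- A continuation v of the prefix s is ≺-last as soon as no admissible continuation w beats it in
-- the Gray order relative to the prefix, i.e. the order on suffixes whose parity bookkeeping starts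
-- at sum s.  Comparing v with w entry by entry, a comparison at an even offset can only be lost by
-- a larger entry, which the growth condition and the bound b forbid beyond min(b, max s + 1); a
-- comparison at an odd offset can only be lost by a smaller entry, impossible against a zero.
-- Hence the last continuation climbs to M while the parity is even and then drops to zeros; when
-- M is even it climbs once more to M + 1, which stays below the odd bound b.
module Submission where

open import Defs
open import Data.Nat using (ℕ; zero; suc; _+_; _∸_; _≤_; _<_; _⊓_; _⊔_; _%_; z≤n; s≤s; _≟_)
open import Data.Nat.Properties
open import Data.Nat.DivMod using (%-distribˡ-+)
open import Data.List using (List; []; _∷_; _++_; length; replicate)
open import Data.List.Properties using (≡-dec; length-++; length-replicate)
open import Data.Nat.ListAction using (sum)
open import Data.List.Relation.Unary.All using (All; _∷_)
open import Data.List.Relation.Unary.All.Properties using (++⁻ˡ; ++⁻ʳ; ++⁺; replicate⁺)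
open import Data.Product using (_×_; Σ; ∃-syntax; _,_; proj₁; proj₂)
open import Data.Sum using (_⊎_; inj₁; inj₂)
open import Data.Unit using (tt)
open import Data.Empty using (⊥-elim)
open import Relation.Nullary using (¬_; yes; no)
open import Relation.Binary.PropositionalEquality

parity-+ : ∀ m n {i j} → m % 2 ≡ i → n % 2 ≡ j → (m + n) % 2 ≡ (i + j) % 2
parity-+ m n refl refl = %-distribˡ-+ m n 2

⊓-even-below-odd : ∀ {b c} → b % 2 ≡ 1 → (b ⊓ suc c) % 2 ≡ 0 → (c < b ⊓ suc c) × (b ⊓ suc c < b)
⊓-even-below-odd {b} {c} odd even with ⊓-sel b (suc c)
... | inj₁ b⊓1+c≡b = ⊥-elim (0≢1+n (trans (sym even) (trans (cong (_% 2) b⊓1+c≡b) odd)))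
... | inj₂ b⊓1+c≡1+c rewrite b⊓1+c≡1+c =
  ≤-refl , ≤∧≢⇒< (subst (_≤ b) b⊓1+c≡1+c (m⊓n≤m b (suc c)))
                  (λ 1+c≡b → 0≢1+n (trans (sym even) (trans (cong (_% 2) 1+c≡b) odd)))

RGFrom-++⁻ : ∀ m xs {v} → RGFrom m (xs ++ v) → RGFrom m xs × RGFrom (m ⊔ maxL xs) v
RGFrom-++⁻ m []       {v} r = tt , subst (λ z → RGFrom z v) (sym (⊔-identityʳ m)) r
RGFrom-++⁻ m (x ∷ xs) {v} (x≤ , r) with RGFrom-++⁻ (m ⊔ x) xs r
... | rxs , rv = (x≤ , rxs) , subst (λ z → RGFrom z v) (⊔-assoc m x (maxL xs)) rv

RGFrom-++⁺ : ∀ m xs {v} → RGFrom m xs → RGFrom (m ⊔ maxL xs) v → RGFrom m (xs ++ v)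
RGFrom-++⁺ m []       {v} _         r = subst (λ z → RGFrom z v) (⊔-identityʳ m) r
RGFrom-++⁺ m (x ∷ xs) {v} (x≤ , rxs) r =
  x≤ , RGFrom-++⁺ (m ⊔ x) xs rxs (subst (λ z → RGFrom z v) (sym (⊔-assoc m x (maxL xs))) r)

RGFrom-zeros : ∀ m L → RGFrom m (replicate L 0)
RGFrom-zeros m zero    = tt
RGFrom-zeros m (suc L) = z≤n , RGFrom-zeros (m ⊔ 0) L

IsRGF-++⁻ : ∀ s {v} → IsRGF (s ++ v) → IsRGF s × RGFrom (maxL s) v
IsRGF-++⁻ []      {[]}    _          = tt , tt
IsRGF-++⁻ []      {x ∷ v} (refl , r) = tt , (z≤n , r)
IsRGF-++⁻ (x ∷ s)         (refl , r) with RGFrom-++⁻ 0 s r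
... | rs , rv = (refl , rs) , rv

IsRGF-++⁺ : ∀ x s {v} → IsRGF (x ∷ s) → RGFrom (maxL (x ∷ s)) v → IsRGF (x ∷ s ++ v)
IsRGF-++⁺ x s (refl , rs) rv = refl , RGFrom-++⁺ 0 s rs rv

-- The continuations of a prefix with maximum m inside R_n(b), up to the length condition.
Admissible : ℕ → ℕ → List ℕ → Set
Admissible m b v = RGFrom m v × All (_≤ b) v

admissible-zeros : ∀ m b L → Admissible m b (replicate L 0)
admissible-zeros m b L = RGFrom-zeros m L , replicate⁺ L z≤n

admissible-∷ : ∀ {m b x v} → x ≤ suc m → x ≤ b → Admissible (m ⊔ x) b v → Admissible m b (x ∷ v)
admissible-∷ x≤1+m x≤b (rv , av) = (x≤1+m , rv) , x≤b ∷ av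

InPrefRnb⇒admissible : ∀ {s n b u} → InPrefRnb s n b u →
  Σ (List ℕ) λ w → u ≡ s ++ w × Admissible (maxL s) b w
InPrefRnb⇒admissible {s} ((w , refl) , _ , rg , al) = w , refl , proj₂ (IsRGF-++⁻ s rg) , ++⁻ʳ s al

-- The Gray order on suffixes following a prefix of sum σ; GrayLt is GrayLtFrom 0 by definition.
GrayLtFrom : ℕ → List ℕ → List ℕ → Set
GrayLtFrom σ s t =
  ∃[ p ] ∃[ x ] ∃[ y ] ∃[ xs ] ∃[ ys ]
    (s ≡ p ++ (x ∷ xs)) × (t ≡ p ++ (y ∷ ys)) ×
    ((((σ + sum p) % 2 ≡ 0) × (x < y)) ⊎ (((σ + sum p) % 2 ≡ 1) × (y < x)))

¬GrayLtFrom-[]ˡ : ∀ {σ t} → ¬ GrayLtFrom σ [] t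
¬GrayLtFrom-[]ˡ ([]    , _ , _ , _ , _ , () , _)
¬GrayLtFrom-[]ˡ (_ ∷ _ , _ , _ , _ , _ , () , _)

¬GrayLtFrom-[]ʳ : ∀ {σ s} → ¬ GrayLtFrom σ s []
¬GrayLtFrom-[]ʳ ([]    , _ , _ , _ , _ , _ , () , _)
¬GrayLtFrom-[]ʳ (_ ∷ _ , _ , _ , _ , _ , _ , () , _)

GrayLtFrom-∷⁻ : ∀ σ {x y xs ys} → GrayLtFrom σ (x ∷ xs) (y ∷ ys) →
  ((σ % 2 ≡ 0) × (x < y)) ⊎ ((σ % 2 ≡ 1) × (y < x)) ⊎ ((x ≡ y) × GrayLtFrom (σ + x) xs ys)
GrayLtFrom-∷⁻ σ ([] , _ , _ , _ , _ , refl , refl , inj₁ (even , lt)) =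
  inj₁ (trans (cong (_% 2) (sym (+-identityʳ σ))) even , lt)
GrayLtFrom-∷⁻ σ ([] , _ , _ , _ , _ , refl , refl , inj₂ (odd , lt)) =
  inj₂ (inj₁ (trans (cong (_% 2) (sym (+-identityʳ σ))) odd , lt))
GrayLtFrom-∷⁻ σ {x} (.x ∷ p , x′ , y′ , xs′ , ys′ , refl , refl , order) =
  inj₂ (inj₂ (refl , p , x′ , y′ , xs′ , ys′ , refl , refl ,
    subst (λ τ → ((τ % 2 ≡ 0) × (x′ < y′)) ⊎ ((τ % 2 ≡ 1) × (y′ < x′)))
          (sym (+-assoc σ x (sum p))) order))

GrayLtFrom-++⁻ : ∀ σ u {v w} → GrayLtFrom σ (u ++ v) (u ++ w) → GrayLtFrom (σ + sum u) v w
GrayLtFrom-++⁻ σ [] {v} {w} lt = subst (λ τ → GrayLtFrom τ v w) (sym (+-identityʳ σ)) lt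
GrayLtFrom-++⁻ σ (a ∷ u) {v} {w} lt with GrayLtFrom-∷⁻ σ lt
... | inj₁ (_ , a<a)        = ⊥-elim (<-irrefl refl a<a)
... | inj₂ (inj₁ (_ , a<a)) = ⊥-elim (<-irrefl refl a<a)
... | inj₂ (inj₂ (_ , lt′)) =
  subst (λ τ → GrayLtFrom τ v w) (+-assoc σ a (sum u)) (GrayLtFrom-++⁻ (σ + a) u lt′)

-- A rival would have to drop below 0 at the first difference.
¬GrayLtFrom-zeros : ∀ σ L {w} → σ % 2 ≡ 1 → ¬ GrayLtFrom σ (replicate L 0) w
¬GrayLtFrom-zeros σ zero            _   lt = ¬GrayLtFrom-[]ˡ {σ} lt
¬GrayLtFrom-zeros σ (suc L) {[]}    _   lt = ¬GrayLtFrom-[]ʳ {σ} lt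
¬GrayLtFrom-zeros σ (suc L) {y ∷ w} odd lt with GrayLtFrom-∷⁻ σ lt
... | inj₁ (even , _)      = 0≢1+n (trans (sym even) odd)
... | inj₂ (inj₁ (_ , ()))
... | inj₂ (inj₂ (_ , lt′)) =
  ¬GrayLtFrom-zeros (σ + 0) L (trans (cong (_% 2) (+-identityʳ σ)) odd) lt′

¬GrayLtFrom-∷ : ∀ σ {x y xs ys} → σ % 2 ≡ 0 → y ≤ x → ¬ GrayLtFrom (σ + x) xs ys →
  ¬ GrayLtFrom σ (x ∷ xs) (y ∷ ys)
¬GrayLtFrom-∷ σ even y≤x rest lt with GrayLtFrom-∷⁻ σ lt
... | inj₁ (_ , x<y)        = <⇒≱ x<y y≤x
... | inj₂ (inj₁ (odd , _)) = 0≢1+n (trans (sym even) odd)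
... | inj₂ (inj₂ (_ , lt′)) = rest lt′

IsGrayLast-unique : ∀ {P : List ℕ → Set} {t c} → IsGrayLast P t → P c →
  (∀ {u} → P u → ¬ GrayLt c u) → t ≡ c
IsGrayLast-unique {t = t} {c} (Pt , last) Pc unbeaten with ≡-dec _≟_ c t
... | yes c≡t = sym c≡t
... | no  c≢t = ⊥-elim (unbeaten Pt (last c Pc c≢t))

IsGrayMaxFrom : ℕ → ℕ → ℕ → List ℕ → Set
IsGrayMaxFrom σ m b v = ∀ {w} → Admissible m b w → ¬ GrayLtFrom σ v w

InPrefRnb-++ : ∀ {s n b u v} → 1 ≤ length s → InPrefRnb s n b u → length (s ++ v) ≡ n →
  Admissible (maxL s) b v → InPrefRnb s n b (s ++ v)
InPrefRnb-++ {x ∷ s} _ ((_ , refl) , _ , rg , al) len (rv , av) =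
  (_ , refl) , len , IsRGF-++⁺ x s (proj₁ (IsRGF-++⁻ (x ∷ s) rg)) rv , ++⁺ (++⁻ˡ (x ∷ s) al) av

IsGrayLast-++ : ∀ {s n b t v} → IsGrayLast (InPrefRnb s n b) t → InPrefRnb s n b (s ++ v) →
  IsGrayMaxFrom (sum s) (maxL s) b v → t ≡ s ++ v
IsGrayLast-++ {s} {n} {b} {v = v} last member max = IsGrayLast-unique last member unbeaten
  where
  unbeaten : ∀ {u} → InPrefRnb s n b u → ¬ GrayLt (s ++ v) u
  unbeaten Pu with InPrefRnb⇒admissible Pu
  ... | _ , refl , adm = λ lt → max adm (GrayLtFrom-++⁻ 0 s lt)

length-padded : ∀ s u n → length s + length u ≤ n →
  length (s ++ u ++ replicate (n ∸ length s ∸ length u) 0) ≡ n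
length-padded s u n fits = begin
  length (s ++ u ++ replicate (n ∸ k ∸ j) 0)  ≡⟨ length-++ s ⟩
  k + length (u ++ replicate (n ∸ k ∸ j) 0)   ≡⟨ cong (k +_) (length-++ u) ⟩
  k + (j + length (replicate (n ∸ k ∸ j) 0))  ≡⟨ cong (λ r → k + (j + r)) (length-replicate (n ∸ k ∸ j)) ⟩
  k + (j + (n ∸ k ∸ j))                       ≡⟨ cong (λ r → k + (j + r)) (∸-+-assoc n k j) ⟩
  k + (j + (n ∸ (k + j)))                     ≡⟨ sym (+-assoc k j _) ⟩
  k + j + (n ∸ (k + j))                       ≡⟨ m+[n∸m]≡n fits ⟩
  n                                           ∎
  where
  open ≡-Reasoning
  k = length s
  j = length u

IsGrayLast-padded : ∀ {s n b t} u → 1 ≤ length s → Σ (List ℕ) (InPrefRnb s n b) →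
  IsGrayLast (InPrefRnb s n b) t → length s + length u ≤ n →
  let v = u ++ replicate (n ∸ length s ∸ length u) 0 in
  Admissible (maxL s) b v → IsGrayMaxFrom (sum s) (maxL s) b v → t ≡ s ++ v
IsGrayLast-padded {s} {n} u 1≤|s| (_ , Pw) last fits adm max =
  IsGrayLast-++ last (InPrefRnb-++ 1≤|s| Pw (length-padded s u n fits) adm) max

zeros-max : ∀ σ m b L → σ % 2 ≡ 1 → IsGrayMaxFrom σ m b (replicate L 0)
zeros-max σ m b L odd _ = ¬GrayLtFrom-zeros σ L odd

peak-zeros-max : ∀ σ m b L → σ % 2 ≡ 0 → (b ⊓ suc m) % 2 ≡ 1 →
  IsGrayMaxFrom σ m b (b ⊓ suc m ∷ replicate L 0)
peak-zeros-max σ m b L even M-odd {[]}    _                       = ¬GrayLtFrom-[]ʳ {σ}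
peak-zeros-max σ m b L even M-odd {y ∷ w} ((y≤1+m , _) , y≤b ∷ _) =
  ¬GrayLtFrom-∷ σ even (⊓-glb y≤b y≤1+m)
    (¬GrayLtFrom-zeros (σ + b ⊓ suc m) L (parity-+ σ (b ⊓ suc m) even M-odd))

peak-step-zeros-max : ∀ σ m b L → σ % 2 ≡ 0 → (b ⊓ suc m) % 2 ≡ 0 → m < b ⊓ suc m →
  IsGrayMaxFrom σ m b (b ⊓ suc m ∷ suc (b ⊓ suc m) ∷ replicate L 0)
peak-step-zeros-max σ m b L even M-even m<M {[]}    _                       = ¬GrayLtFrom-[]ʳ {σ}
peak-step-zeros-max σ m b L even M-even m<M {y ∷ w} ((y≤1+m , rw) , y≤b ∷ _) =
  ¬GrayLtFrom-∷ σ even y≤M (step w rw)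
  where
  M = b ⊓ suc m
  y≤M : y ≤ M
  y≤M = ⊓-glb y≤b y≤1+m
  even′ : (σ + M) % 2 ≡ 0
  even′ = parity-+ σ M even M-even
  step : ∀ w → RGFrom (m ⊔ y) w → ¬ GrayLtFrom (σ + M) (suc M ∷ replicate L 0) w
  step []       _           = ¬GrayLtFrom-[]ʳ {σ + M}
  step (y′ ∷ w) (y′≤ , _) =
    ¬GrayLtFrom-∷ (σ + M) even′ (≤-trans y′≤ (s≤s (⊔-lub (<⇒≤ m<M) y≤M)))
      (¬GrayLtFrom-zeros (σ + M + suc M) L (parity-+ (σ + M) (suc M) even′ (parity-+ 1 M refl M-even)))

proposition1 : (b n k : ℕ) (s : List ℕ) → b % 2 ≡ 1 → 1 ≤ k → k + 2 ≤ n →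
    length s ≡ k → Σ (List ℕ) (InPrefRnb s n b) →
    (t : List ℕ) → IsGrayLast (InPrefRnb s n b) t →
    let M = b ⊓ suc (maxL s) in
    (sum s % 2 ≡ 0 → M % 2 ≡ 1 → t ≡ s ++ (M ∷ replicate (n ∸ k ∸ 1) 0)) ×
    (sum s % 2 ≡ 0 → M % 2 ≡ 0 → t ≡ s ++ (M ∷ suc M ∷ replicate (n ∸ k ∸ 2) 0)) ×
    (sum s % 2 ≡ 1 → t ≡ s ++ replicate (n ∸ k) 0)
proposition1 b n k s b-odd 1≤k k+2≤n refl nonempty t last = case-peak , case-peak-step , case-zeros
  where
  σ = sum s
  m = maxL s
  M = b ⊓ suc m

  M≤b : M ≤ b
  M≤b = m⊓n≤m b (suc m)

  M≤1+m : M ≤ suc m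
  M≤1+m = m⊓n≤n b (suc m)

  padded : ∀ u → length u ≤ 2 → let v = u ++ replicate (n ∸ length s ∸ length u) 0 in
    Admissible m b v → IsGrayMaxFrom σ m b v → t ≡ s ++ v
  padded u |u|≤2 = IsGrayLast-padded u 1≤k nonempty last (≤-trans (+-monoʳ-≤ (length s) |u|≤2) k+2≤n)

  case-peak : σ % 2 ≡ 0 → M % 2 ≡ 1 → t ≡ s ++ (M ∷ replicate (n ∸ length s ∸ 1) 0)
  case-peak even M-odd = padded (M ∷ []) (s≤s z≤n)
    (admissible-∷ M≤1+m M≤b (admissible-zeros (m ⊔ M) b _))
    (peak-zeros-max σ m b _ even M-odd)

  case-peak-step : σ % 2 ≡ 0 → M % 2 ≡ 0 → t ≡ s ++ (M ∷ suc M ∷ replicate (n ∸ length s ∸ 2) 0)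
  case-peak-step even M-even with ⊓-even-below-odd b-odd M-even
  ... | m<M , M<b = padded (M ∷ suc M ∷ []) ≤-refl
    (admissible-∷ M≤1+m M≤b (admissible-∷ (s≤s (m≤n⊔m m M)) M<b (admissible-zeros (m ⊔ M ⊔ suc M) b _)))
    (peak-step-zeros-max σ m b _ even M-even m<M)

  case-zeros : σ % 2 ≡ 1 → t ≡ s ++ replicate (n ∸ length s) 0
  case-zeros odd = padded [] z≤n (admissible-zeros m b _) (zeros-max σ m b _ odd)
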